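{- Let $p$ be a positive integer. Then $$\mathrm{ex}(p+5,B_p)=\begin{cases}\frac{(p+2)(p+5)}{2} & \text{if } p\equiv 1 \pmod 3,\\ \frac{(p+1)(p+6)}{2} & \text{if } p\equiv 0 \text{ or } 2 \pmod 3.\end{cases}$$
   Context: The book $B_p$ is the graph consisting of $p$ triangles sharing a common edge. For a graph $H$ and positive integer $n$, $\mathrm{ex}(n,H)$ is the maximum number of edges of a simple graph of order $n$ not containing $H$ as a subgraph. -}

module Defs where

open import Data.Nat using (ℕ; _+_; _*_; _≤_; _<ᵇ_)
open import Data.Bool using (Bool; true; false; if_then_else_; _∧_)
open import Data.Fin using (Fin; toℕ)
open import Data.List using (map; allFin)
open import Data.Nat.ListAction using (sum)
open import Data.Product using (Σ; _×_)
open import Relation.Binary.PropositionalEquality using (_≡_; _≢_)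
open import Relation.Nullary using (¬_)

record SimpleGraph (n : ℕ) : Set where
  field
    adj   : Fin n → Fin n → Bool
    sym   : ∀ i j → adj i j ≡ adj j i
    irrefl : ∀ i → adj i i ≡ false
open SimpleGraph public

edgeCount : {n : ℕ} → SimpleGraph n → ℕ
edgeCount {n} G =
  sum (map (λ i → sum (map (λ j → if (toℕ i <ᵇ toℕ j) ∧ adj G i j then 1 else 0)
                           (allFin n)))
           (allFin n))

-- G contains the book B_p (p triangles sharing a common edge uv) as a subgraph:
-- an edge uv and p distinct vertices w_1..w_p, different from u and v, each adjacent to u and v.
ContainsBook : {n : ℕ} → ℕ → SimpleGraph n → Set
ContainsBook {n} p G =
  Σ (Fin n) λ u → Σ (Fin n) λ v →
    u ≢ v × adj G u v ≡ true ×
    Σ (Fin p → Fin n) λ w →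
      (∀ k l → w k ≡ w l → k ≡ l) ×
      (∀ k → w k ≢ u × w k ≢ v × adj G u (w k) ≡ true × adj G v (w k) ≡ true)

ExBookIs : ℕ → ℕ → ℕ → Set
ExBookIs n p m =
  (Σ (SimpleGraph n) λ G → ¬ ContainsBook p G × edgeCount G ≡ m) ×
  (∀ (G : SimpleGraph n) → ¬ ContainsBook p G → edgeCount G ≤ m)

module Submission where

-- Pass to the complement H of G. For an edge uv of G every vertex other than u, v is a common
-- neighbour or an H-neighbour of u or v, so G on n = p + 5 vertices is B_p-free iff any two distinct
-- non-adjacent vertices of H have at least 4 neighbours between them (Spread 4 H), and maximising
-- e(G) means minimising e(H). Such an H has e(H) ≥ n: if some vertex has degree ≤ 1, its
-- non-neighbours have degree ≥ 3 and the degree sum is ≥ 3n − 4; otherwise all degrees are ≥ 2.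
-- If moreover e(H) ≤ n + 1, at most two vertices have degree 3 and the rest degree 2, and Spread puts
-- every vertex on exactly one triangle of H, so 3 ∣ n; otherwise e(H) ≥ n + 2. The bounds are attained
-- by disjoint unions of triangles with nothing, with K₄, or with an 8-vertex graph, as n ≡ 0, 1, 2.

open import Data.Bool using (Bool; true; false; not; _∧_; _∨_; if_then_else_)
open import Data.Bool.Properties using (∧-identityʳ; ∧-zeroʳ; ∨-identityʳ; not-involutive)
import Data.Bool.Properties as Boolₚ
open import Data.Empty using (⊥; ⊥-elim)
open import Data.Fin using (Fin; zero; suc; toℕ; punchIn; punchOut; _≟_; _↑ˡ_; _↑ʳ_; splitAt)
import Data.Fin.Properties as Finₚ
open import Data.List using (map; tabulate; allFin)
open import Data.Nat using (ℕ; zero; suc; _+_; _*_; _∸_; _≤_; _<_; _<ᵇ_; _≡ᵇ_; _≤?_; _<?_; z≤n; s≤s)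
open import Data.Nat.Divisibility using (_∣_; divides; _∣?_; ∣m+n∣m⇒∣n)
open import Data.Nat.DivMod using (_%_; _/_; m*n/n≡m; /-monoˡ-≤; m*n%n≡0; [m+kn]%n≡m%n)
import Data.Nat.ListAction as List
open import Data.Nat.Properties hiding (_≟_)
open import Data.Nat.Tactic.RingSolver using (solve-∀)
open import Data.Product using (Σ; _×_; _,_; ∃; proj₁; proj₂)
open import Data.Sum using (_⊎_; inj₁; inj₂; [_,_]′)
open import Data.Vec.Functional using ([]; _∷_)
open import Function using (_∘_; id; case_of_)
open import Function.Definitions using (Injective)
open import Relation.Binary.PropositionalEquality
open import Relation.Nullary using (¬_; Dec; yes; no; does; ¬?)
open import Relation.Nullary.Decidable using (_→-dec_; from-yes; from-no)
open import Algebra.Properties.CommutativeMonoid.Sum +-0-commutativeMonoid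
  using (sum; sum-syntax; sum-cong-≗; sum-replicate-zero; ∑-distrib-+; ∑-comm; sum-remove)
open import Algebra.Properties.Semiring.Sum +-*-semiring using (*-distribˡ-sum)

open import Defs hiding (sym)

3*m≡m+m+m : ∀ m → 3 * m ≡ m + m + m
3*m≡m+m+m = solve-∀

m+m≤n+n⇒m≤n : ∀ {m n} → m + m ≤ n + n → m ≤ n
m+m≤n+n⇒m≤n {m} {n} m+m≤n+n with m ≤? n
... | yes m≤n = m≤n
... | no  m≰n = ⊥-elim (<⇒≱ (+-mono-< (≰⇒> m≰n) (≰⇒> m≰n)) m+m≤n+n)

m+m≡n+n⇒m≡n : ∀ {m n} → m + m ≡ n + n → m ≡ n
m+m≡n+n⇒m≡n eq = ≤-antisym (m+m≤n+n⇒m≤n (≤-reflexive eq)) (m+m≤n+n⇒m≤n (≤-reflexive (sym eq)))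

m+m<n+n⇒m<n : ∀ {m n} → m + m < n + n → m < n
m+m<n+n⇒m<n {m} {n} m+m<n+n with m <? n
... | yes m<n = m<n
... | no  m≮n = ⊥-elim (<⇒≱ m+m<n+n (+-mono-≤ (≮⇒≥ m≮n) (≮⇒≥ m≮n)))

m+m≡n⇒n/2≡m : ∀ {m n} → m + m ≡ n → n / 2 ≡ m
m+m≡n⇒n/2≡m {m} refl = trans (cong (_/ 2) (sym (m*2≡m+m m))) (m*n/n≡m m 2)
  where
  m*2≡m+m : ∀ m → m * 2 ≡ m + m
  m*2≡m+m = solve-∀

m+m≤n⇒m≤n/2 : ∀ {m n} → m + m ≤ n → m ≤ n / 2
m+m≤n⇒m≤n/2 {m} m+m≤n = subst (_≤ _) (m+m≡n⇒n/2≡m refl) (/-monoˡ-≤ 2 m+m≤n)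

𝟙 : Bool → ℕ
𝟙 b = if b then 1 else 0

∑-const : ∀ n c → ∑[ i < n ] c ≡ n * c
∑-const zero    c = refl
∑-const (suc n) c = cong (c +_) (∑-const n c)

∑-1 : ∀ n → ∑[ i < n ] 1 ≡ n
∑-1 zero    = refl
∑-1 (suc n) = cong suc (∑-1 n)

∑-mono-≤ : ∀ {n} {f g : Fin n → ℕ} → (∀ i → f i ≤ g i) → sum f ≤ sum g
∑-mono-≤ {zero}  f≤g = z≤n
∑-mono-≤ {suc n} f≤g = +-mono-≤ (f≤g zero) (∑-mono-≤ (f≤g ∘ suc))

∑-∘-injective-≤ : ∀ {k n} (f : Fin n → ℕ) (w : Fin k → Fin n) →
                  Injective _≡_ _≡_ w → sum (f ∘ w) ≤ sum f
∑-∘-injective-≤ {zero}  f w w-inj = z≤n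
∑-∘-injective-≤ {suc k} {zero} f w w-inj with w zero
... | ()
∑-∘-injective-≤ {suc k} {suc n} f w w-inj = begin
  f (w zero) + sum (f ∘ w ∘ suc)
    ≡⟨ cong (f (w zero) +_) (sum-cong-≗ (cong f ∘ sym ∘ punchIn-w′)) ⟩
  f (w zero) + sum (f ∘ punchIn (w zero) ∘ w′)
    ≤⟨ +-monoʳ-≤ (f (w zero)) (∑-∘-injective-≤ (f ∘ punchIn (w zero)) w′ w′-inj) ⟩
  f (w zero) + sum (f ∘ punchIn (w zero))
    ≡⟨ sum-remove {i = w zero} f ⟨
  sum f ∎
  where
  open ≤-Reasoning
  w₀≢w : ∀ j → w zero ≢ w (suc j)
  w₀≢w j eq with w-inj eq
  ... | ()
  w′ : Fin k → Fin n
  w′ j = punchOut (w₀≢w j)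
  punchIn-w′ : ∀ j → punchIn (w zero) (w′ j) ≡ w (suc j)
  punchIn-w′ j = Finₚ.punchIn-punchOut (w₀≢w j)
  w′-inj : Injective _≡_ _≡_ w′
  w′-inj {i} {j} eq = Finₚ.suc-injective (w-inj (Finₚ.punchOut-injective (w₀≢w i) (w₀≢w j) eq))

∧-true : ∀ {a b} → (a ∧ b) ≡ true → a ≡ true × b ≡ true
∧-true {true} {true} _ = refl , refl

count : ∀ {n} → (Fin n → Bool) → ℕ
count P = sum (𝟙 ∘ P)

count-cong : ∀ {n} {P Q : Fin n → Bool} → (∀ i → P i ≡ Q i) → count P ≡ count Q
count-cong P≗Q = sum-cong-≗ (cong 𝟙 ∘ P≗Q)

count-false : ∀ n → count {n} (λ _ → false) ≡ 0
count-false = sum-replicate-zero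

infix 4 _==_
_==_ : ∀ {n} → Fin n → Fin n → Bool
i == j = does (i ≟ j)

==-refl : ∀ {n} (i : Fin n) → (i == i) ≡ true
==-refl i with i ≟ i
... | yes _   = refl
... | no i≢i = ⊥-elim (i≢i refl)

≢⇒== : ∀ {n} {i j : Fin n} → i ≢ j → (i == j) ≡ false
≢⇒== {i = i} {j} i≢j with i ≟ j
... | yes i≡j = ⊥-elim (i≢j i≡j)
... | no _    = refl

==-sym : ∀ {n} (i j : Fin n) → (i == j) ≡ (j == i)
==-sym i j with i ≟ j | j ≟ i
... | yes _   | yes _   = refl
... | no _    | no _    = refl
... | yes i≡j | no j≢i = ⊥-elim (j≢i (sym i≡j))
... | no i≢j | yes j≡i = ⊥-elim (i≢j (sym j≡i))

count-point : ∀ {n} (a : Fin n) → count (_== a) ≡ 1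
count-point {suc n} a = begin
  count (_== a)                            ≡⟨ sum-remove {i = a} (𝟙 ∘ (_== a)) ⟩
  𝟙 (a == a) + count ((_== a) ∘ punchIn a) ≡⟨ cong₂ _+_ (cong 𝟙 (==-refl a)) (count-cong (≢⇒== ∘ Finₚ.punchInᵢ≢i a)) ⟩
  1 + ∑[ i < n ] 0                         ≡⟨ cong suc (sum-replicate-zero n) ⟩
  1                                        ∎
  where open ≡-Reasoning

≤-count : ∀ {k n} (P : Fin n → Bool) (w : Fin k → Fin n) → Injective _≡_ _≡_ w →
          (∀ i → P (w i) ≡ true) → k ≤ count P
≤-count {k} P w w-inj Pw = begin
  k                   ≡⟨ ∑-1 k ⟨
  ∑[ i < k ] 1        ≡⟨ count-cong Pw ⟨
  sum (𝟙 ∘ P ∘ w)     ≤⟨ ∑-∘-injective-≤ (𝟙 ∘ P) w w-inj ⟩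
  count P             ∎
  where open ≤-Reasoning

∷-injective : ∀ {k n} {x : Fin n} {w : Fin k → Fin n} → (∀ i → w i ≢ x) →
              Injective _≡_ _≡_ w → Injective _≡_ _≡_ (x ∷ w)
∷-injective x∉w w-inj {zero}  {zero}  _  = refl
∷-injective x∉w w-inj {zero}  {suc j} eq = ⊥-elim (x∉w j (sym eq))
∷-injective x∉w w-inj {suc i} {zero}  eq = ⊥-elim (x∉w i eq)
∷-injective x∉w w-inj {suc i} {suc j} eq = cong suc (w-inj eq)

[]-injective : ∀ {n} → Injective _≡_ _≡_ ([] {A = Fin n})
[]-injective {x = ()}

pair-injective : ∀ {n} {x y : Fin n} → x ≢ y → Injective _≡_ _≡_ (x ∷ y ∷ [])
pair-injective x≢y = ∷-injective (λ { zero → x≢y ∘ sym }) (∷-injective (λ ()) []-injective)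

triple-injective : ∀ {n} {x y z : Fin n} → x ≢ y → x ≢ z → y ≢ z → Injective _≡_ _≡_ (x ∷ y ∷ z ∷ [])
triple-injective x≢y x≢z y≢z =
  ∷-injective (λ { zero → x≢y ∘ sym ; (suc zero) → x≢z ∘ sym }) (pair-injective y≢z)

count≥⇒injection : ∀ {n} k (P : Fin n → Bool) → k ≤ count P →
                   Σ (Fin k → Fin n) λ w → Injective _≡_ _≡_ w × (∀ i → P (w i) ≡ true)
count≥⇒injection zero P _ = (λ ()) , (λ {}) , (λ ())
count≥⇒injection {zero} (suc k) P ()
count≥⇒injection {suc n} (suc k) P k<count with P zero in P0
... | true  =
  let w , w-inj , Pw = count≥⇒injection k (P ∘ suc) (≤-pred k<count) in
  zero ∷ suc ∘ w , ∷-injective (λ _ ()) (w-inj ∘ Finₚ.suc-injective) , λ { zero → P0 ; (suc i) → Pw i }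
... | false =
  let w , w-inj , Pw = count≥⇒injection (suc k) (P ∘ suc) k<count in
  suc ∘ w , w-inj ∘ Finₚ.suc-injective , Pw

-- An injection of the right size must hit every point of P, or else it extends to a larger one.
count≡⇒surjective : ∀ {k n} (P : Fin n → Bool) (w : Fin k → Fin n) → Injective _≡_ _≡_ w →
                    (∀ i → P (w i) ≡ true) → count P ≡ k → ∀ j → P j ≡ true → ∃ λ i → w i ≡ j
count≡⇒surjective P w w-inj Pw count≡k j Pj with Finₚ.any? (λ i → w i ≟ j)
... | yes j∈w = j∈w
... | no  j∉w = ⊥-elim (<-irrefl (sym count≡k)
                  (≤-count P (j ∷ w) (∷-injective (λ i wi≡j → j∉w (i , wi≡j)) w-inj)
                                     λ { zero → Pj ; (suc i) → Pw i }))

count≥1 : ∀ {n} (P : Fin n → Bool) {j} → P j ≡ true → 1 ≤ count P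
count≥1 P Pj = ≤-count P (_ ∷ []) (∷-injective (λ ()) []-injective) λ { zero → Pj }

count-∨+∧ : ∀ {n} (P Q : Fin n → Bool) →
            count (λ w → P w ∨ Q w) + count (λ w → P w ∧ Q w) ≡ count P + count Q
count-∨+∧ P Q = begin
  count (λ w → P w ∨ Q w) + count (λ w → P w ∧ Q w)  ≡⟨ ∑-distrib-+ (𝟙 ∘ (λ w → P w ∨ Q w)) (𝟙 ∘ (λ w → P w ∧ Q w)) ⟨
  sum (λ w → 𝟙 (P w ∨ Q w) + 𝟙 (P w ∧ Q w))         ≡⟨ sum-cong-≗ (λ w → pointwise (P w) (Q w)) ⟩
  sum (λ w → 𝟙 (P w) + 𝟙 (Q w))                     ≡⟨ ∑-distrib-+ (𝟙 ∘ P) (𝟙 ∘ Q) ⟩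
  count P + count Q                                  ∎
  where
  open ≡-Reasoning
  pointwise : ∀ a b → 𝟙 (a ∨ b) + 𝟙 (a ∧ b) ≡ 𝟙 a + 𝟙 b
  pointwise true  true  = refl
  pointwise true  false = refl
  pointwise false b     = +-identityʳ (𝟙 b)

∑-↑ : ∀ a {b} (f : Fin (a + b) → ℕ) → sum f ≡ sum (f ∘ (_↑ˡ b)) + sum (f ∘ (a ↑ʳ_))
∑-↑ zero    f = refl
∑-↑ (suc a) f = trans (cong (f zero +_) (∑-↑ a (f ∘ suc))) (sym (+-assoc (f zero) _ _))

∑∑∑ : ∀ {n} → (Fin n → Fin n → Fin n → ℕ) → ℕ
∑∑∑ {n} f = ∑[ x < n ] ∑[ y < n ] ∑[ z < n ] f x y z

∑∑∑-distrib-+ : ∀ {n} (f g : Fin n → Fin n → Fin n → ℕ) →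
                ∑∑∑ (λ x y z → f x y z + g x y z) ≡ ∑∑∑ f + ∑∑∑ g
∑∑∑-distrib-+ {n} f g = trans
  (sum-cong-≗ λ x → trans (sum-cong-≗ λ y → ∑-distrib-+ (f x y) (g x y))
                          (∑-distrib-+ (λ y → sum (f x y)) (λ y → sum (g x y))))
  (∑-distrib-+ (λ x → ∑[ y < n ] sum (f x y)) (λ x → ∑[ y < n ] sum (g x y)))

∑-point : ∀ {n} (a : Fin n) c → ∑[ y < n ] (𝟙 (y == a) * c) ≡ c
∑-point {n} a c = begin
  ∑[ y < n ] (𝟙 (y == a) * c)  ≡⟨ sum-cong-≗ (λ y → *-comm (𝟙 (y == a)) c) ⟩
  ∑[ y < n ] (c * 𝟙 (y == a))  ≡⟨ *-distribˡ-sum c (𝟙 ∘ (_== a)) ⟨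
  c * count (_== a)            ≡⟨ cong (c *_) (count-point a) ⟩
  c * 1                        ≡⟨ *-identityʳ c ⟩
  c                            ∎
  where open ≡-Reasoning

count-single : ∀ {n} (P : Fin n → Bool) z₀ → (∀ z → P z ≡ true → z ≡ z₀) → count P ≡ 𝟙 (P z₀)
count-single P z₀ P⊆z₀ = trans (sum-cong-≗ pointwise) (∑-point z₀ (𝟙 (P z₀)))
  where
  pointwise : ∀ z → 𝟙 (P z) ≡ 𝟙 (z == z₀) * 𝟙 (P z₀)
  pointwise z with z ≟ z₀
  ... | yes refl = sym (+-identityʳ _)
  ... | no z≢z₀ with P z in Pz
  ...   | true  = ⊥-elim (z≢z₀ (P⊆z₀ z Pz))
  ...   | false = refl

<ᵇ-trans : ∀ a b c → (a <ᵇ b) ≡ true → (b <ᵇ c) ≡ true → (a <ᵇ c) ≡ true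
<ᵇ-trans zero    (suc b) (suc c) _   _   = refl
<ᵇ-trans (suc a) (suc b) (suc c) a<b b<c = <ᵇ-trans a b c a<b b<c
<ᵇ-trans _       zero    _       ()  _
<ᵇ-trans zero    (suc b) zero    _   ()
<ᵇ-trans (suc a) (suc b) zero    _   ()

<ᵇ-flip : ∀ a b → a ≢ b → (b <ᵇ a) ≡ not (a <ᵇ b)
<ᵇ-flip zero    zero    a≢b = ⊥-elim (a≢b refl)
<ᵇ-flip zero    (suc b) _   = refl
<ᵇ-flip (suc a) zero    _   = refl
<ᵇ-flip (suc a) (suc b) a≢b = <ᵇ-flip a b (a≢b ∘ cong suc)

<ᵇ-trichotomy : ∀ {a b c} → a ≢ b → a ≢ c → b ≢ c →
  𝟙 (b <ᵇ c) ≡ 𝟙 ((a <ᵇ b) ∧ (b <ᵇ c)) + 𝟙 ((b <ᵇ a) ∧ (a <ᵇ c)) + 𝟙 ((b <ᵇ c) ∧ (c <ᵇ a))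
<ᵇ-trichotomy {a} {b} {c} a≢b a≢c b≢c rewrite <ᵇ-flip a b a≢b | <ᵇ-flip a c a≢c
  with a <ᵇ b in a<b | b <ᵇ c in b<c | a <ᵇ c in a<c
... | true  | true  | true  = refl
... | true  | true  | false with trans (sym (<ᵇ-trans a b c a<b b<c)) a<c
...   | ()
<ᵇ-trichotomy _ _ _ | true  | false | _     = refl
<ᵇ-trichotomy _ _ _ | false | true  | true  = refl
<ᵇ-trichotomy _ _ _ | false | true  | false = refl
<ᵇ-trichotomy _ _ _ | false | false | false = refl
<ᵇ-trichotomy {a} {b} {c} a≢b a≢c b≢c | false | false | true
  with trans (sym (<ᵇ-trans c b a (trans (<ᵇ-flip b c b≢c) (cong not b<c)) (trans (<ᵇ-flip a b a≢b) (cong not a<b))))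
             (trans (<ᵇ-flip a c a≢c) (cong not a<c))
... | ()

infix 7 _≺_
_≺_ : ∀ {n} → Fin n → Fin n → Bool
i ≺ j = toℕ i <ᵇ toℕ j

≺-connex : ∀ {n} {i j : Fin n} → i ≢ j → 𝟙 (i ≺ j) + 𝟙 (j ≺ i) ≡ 1
≺-connex {i = i} {j} i≢j rewrite <ᵇ-flip (toℕ i) (toℕ j) (i≢j ∘ Finₚ.toℕ-injective) with i ≺ j
... | true  = refl
... | false = refl

listSum-map-tabulate : ∀ {n} {A : Set} (f : A → ℕ) (g : Fin n → A) →
                       List.sum (map f (tabulate g)) ≡ sum (f ∘ g)
listSum-map-tabulate {zero}  f g = refl
listSum-map-tabulate {suc n} f g = cong (f (g zero) +_) (listSum-map-tabulate f (g ∘ suc))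

module _ {n : ℕ} where

  degree : SimpleGraph n → Fin n → ℕ
  degree G u = count (adj G u)

  adj⇒≢ : ∀ (G : SimpleGraph n) {u v} → adj G u v ≡ true → u ≢ v
  adj⇒≢ G {u} Guv refl with trans (sym Guv) (irrefl G u)
  ... | ()

  edgeCount≡∑∑ : ∀ G → edgeCount G ≡ ∑[ i < n ] ∑[ j < n ] 𝟙 (i ≺ j ∧ adj G i j)
  edgeCount≡∑∑ G = trans (listSum-map-tabulate (λ i → List.sum (map (λ j → 𝟙 (i ≺ j ∧ adj G i j)) (allFin n))) id)
                         (sum-cong-≗ (λ i → listSum-map-tabulate (λ j → 𝟙 (i ≺ j ∧ adj G i j)) id))

  handshake : ∀ G → edgeCount G + edgeCount G ≡ sum (degree G)
  handshake G = begin
    edgeCount G + edgeCount G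
      ≡⟨ cong₂ _+_ (edgeCount≡∑∑ G) (trans (edgeCount≡∑∑ G) (∑-comm (λ i j → 𝟙 (i ≺ j ∧ adj G i j)))) ⟩
    sum (λ i → sum (λ j → 𝟙 (i ≺ j ∧ adj G i j))) + sum (λ i → sum (λ j → 𝟙 (j ≺ i ∧ adj G j i)))
      ≡⟨ ∑-distrib-+ (λ i → sum (λ j → 𝟙 (i ≺ j ∧ adj G i j))) _ ⟨
    sum (λ i → sum (λ j → 𝟙 (i ≺ j ∧ adj G i j)) + sum (λ j → 𝟙 (j ≺ i ∧ adj G j i)))
      ≡⟨ sum-cong-≗ (λ i → trans (sym (∑-distrib-+ (λ j → 𝟙 (i ≺ j ∧ adj G i j)) _)) (sum-cong-≗ (pointwise i))) ⟩
    sum (degree G)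
      ∎
    where
    open ≡-Reasoning
    pointwise : ∀ i j → 𝟙 (i ≺ j ∧ adj G i j) + 𝟙 (j ≺ i ∧ adj G j i) ≡ 𝟙 (adj G i j)
    pointwise i j rewrite SimpleGraph.sym G j i with adj G i j in Gij
    ... | true  = trans (cong₂ (λ x y → 𝟙 x + 𝟙 y) (∧-identityʳ (i ≺ j)) (∧-identityʳ (j ≺ i)))
                        (≺-connex (adj⇒≢ G Gij))
    ... | false = cong₂ (λ x y → 𝟙 x + 𝟙 y) (∧-zeroʳ (i ≺ j)) (∧-zeroʳ (j ≺ i))

  Complementary : SimpleGraph n → SimpleGraph n → Set
  Complementary G H = ∀ u v → u ≢ v → adj H u v ≡ not (adj G u v)

  complement : SimpleGraph n → SimpleGraph n
  complement G = record
    { adj    = λ u v → not (u == v) ∧ not (adj G u v)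
    ; sym    = λ u v → cong₂ (λ x y → not x ∧ not y) (==-sym u v) (SimpleGraph.sym G u v)
    ; irrefl = λ u → cong (λ x → not x ∧ not (adj G u u)) (==-refl u)
    }

  complement-complementary : ∀ G → Complementary G (complement G)
  complement-complementary G u v u≢v rewrite ≢⇒== u≢v = refl

  complementary-sym : ∀ {G H} → Complementary G H → Complementary H G
  complementary-sym {G} {H} G~H u v u≢v = begin
    adj G u v             ≡⟨ not-involutive (adj G u v) ⟨
    not (not (adj G u v)) ≡⟨ cong not (G~H u v u≢v) ⟨
    not (adj H u v)       ∎
    where open ≡-Reasoning

  degree-complementary : ∀ {G H} → Complementary G H → ∀ u → degree G u + degree H u + 1 ≡ n
  degree-complementary {G} {H} G~H u = begin
    degree G u + degree H u + 1
      ≡⟨ cong (degree G u + degree H u +_) (count-point u) ⟨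
    count (adj G u) + count (adj H u) + count (_== u)
      ≡⟨ cong (_+ count (_== u)) (∑-distrib-+ (𝟙 ∘ adj G u) (𝟙 ∘ adj H u)) ⟨
    sum (λ w → 𝟙 (adj G u w) + 𝟙 (adj H u w)) + count (_== u)
      ≡⟨ ∑-distrib-+ (λ w → 𝟙 (adj G u w) + 𝟙 (adj H u w)) (𝟙 ∘ (_== u)) ⟨
    sum (λ w → 𝟙 (adj G u w) + 𝟙 (adj H u w) + 𝟙 (w == u))
      ≡⟨ sum-cong-≗ pointwise ⟩
    ∑[ w < n ] 1
      ≡⟨ ∑-1 n ⟩
    n ∎
    where
    open ≡-Reasoning
    pointwise : ∀ w → 𝟙 (adj G u w) + 𝟙 (adj H u w) + 𝟙 (w == u) ≡ 1
    pointwise w with w ≟ u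
    ... | yes refl rewrite irrefl G w | irrefl H w = refl
    ... | no w≢u rewrite G~H u w (w≢u ∘ sym) with adj G u w
    ...   | true  = refl
    ...   | false = refl

  edgeCount-complementary : ∀ {G H} → Complementary G H →
    (edgeCount G + edgeCount G) + (edgeCount H + edgeCount H) + n ≡ n * n
  edgeCount-complementary {G} {H} G~H = begin
    (edgeCount G + edgeCount G) + (edgeCount H + edgeCount H) + n
      ≡⟨ cong₂ (λ x y → x + y + n) (handshake G) (handshake H) ⟩
    sum (degree G) + sum (degree H) + n
      ≡⟨ cong (sum (degree G) + sum (degree H) +_) (∑-1 n) ⟨
    sum (degree G) + sum (degree H) + ∑[ u < n ] 1
      ≡⟨ cong (_+ ∑[ u < n ] 1) (∑-distrib-+ (degree G) (degree H)) ⟨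
    sum (λ u → degree G u + degree H u) + ∑[ u < n ] 1
      ≡⟨ ∑-distrib-+ (λ u → degree G u + degree H u) (λ _ → 1) ⟨
    sum (λ u → degree G u + degree H u + 1)
      ≡⟨ sum-cong-≗ (degree-complementary {G} {H} G~H) ⟩
    ∑[ u < n ] n
      ≡⟨ ∑-const n n ⟩
    n * n ∎
    where open ≡-Reasoning

  -- For the complement H of a graph G on p + 5 vertices, Spread 4 H says that G is B_p-free: an edge
  -- uv of G has p common neighbours iff at most 3 other vertices are H-adjacent to u or v.
  Spread : ℕ → SimpleGraph n → Set
  Spread k H = ∀ u v → u ≢ v → adj H u v ≡ false → k ≤ count (λ w → adj H u w ∨ adj H v w)

  commonNeighbours+jointComplementNeighbours : ∀ {G H} → Complementary G H → ∀ {u v} → adj G u v ≡ true →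
    count (λ w → adj G u w ∧ adj G v w) + count (λ w → adj H u w ∨ adj H v w) + 2 ≡ n
  commonNeighbours+jointComplementNeighbours {G} {H} G~H {u} {v} Guv = begin
    c + d + 2
      ≡⟨ cong (c + d +_) (cong₂ _+_ (count-point u) (count-point v)) ⟨
    c + d + (count (_== u) + count (_== v))
      ≡⟨ +-assoc (c + d) _ _ ⟨
    c + d + count (_== u) + count (_== v)
      ≡⟨ cong (λ x → x + count (_== u) + count (_== v)) (∑-distrib-+ (𝟙 ∘ common) (𝟙 ∘ joint)) ⟨
    sum (λ w → 𝟙 (common w) + 𝟙 (joint w)) + count (_== u) + count (_== v)
      ≡⟨ cong (_+ count (_== v)) (∑-distrib-+ (λ w → 𝟙 (common w) + 𝟙 (joint w)) (𝟙 ∘ (_== u))) ⟨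
    sum (λ w → 𝟙 (common w) + 𝟙 (joint w) + 𝟙 (w == u)) + count (_== v)
      ≡⟨ ∑-distrib-+ (λ w → 𝟙 (common w) + 𝟙 (joint w) + 𝟙 (w == u)) (𝟙 ∘ (_== v)) ⟨
    sum (λ w → 𝟙 (common w) + 𝟙 (joint w) + 𝟙 (w == u) + 𝟙 (w == v))
      ≡⟨ sum-cong-≗ pointwise ⟩
    ∑[ w < n ] 1                              ≡⟨ ∑-1 n ⟩
    n                                         ∎
    where
    open ≡-Reasoning
    common joint : Fin n → Bool
    common w = adj G u w ∧ adj G v w
    joint  w = adj H u w ∨ adj H v w
    c = count common
    d = count joint
    u≢v = adj⇒≢ G Guv
    pointwise : ∀ w → 𝟙 (common w) + 𝟙 (joint w) + 𝟙 (w == u) + 𝟙 (w == v) ≡ 1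
    pointwise w with w ≟ u | w ≟ v
    ... | yes refl | yes refl = ⊥-elim (u≢v refl)
    ... | yes refl | no w≢v
      rewrite irrefl G w | irrefl H w | G~H v w (w≢v ∘ sym) | SimpleGraph.sym G v w | Guv = refl
    ... | no w≢u | yes refl
      rewrite irrefl G w | irrefl H w | G~H u w (w≢u ∘ sym) | Guv = refl
    ... | no w≢u | no w≢v
      rewrite G~H u w (w≢u ∘ sym) | G~H v w (w≢v ∘ sym) with adj G u w | adj G v w
    ...   | true  | true  = refl
    ...   | true  | false = refl
    ...   | false | true  = refl
    ...   | false | false = refl

commonNeighbours⇒containsBook : ∀ {n} p (G : SimpleGraph n) {u v} → adj G u v ≡ true →
  p ≤ count (λ w → adj G u w ∧ adj G v w) → ContainsBook p G
commonNeighbours⇒containsBook p G {u} {v} Guv p≤c =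
  let w , w-inj , common-w = count≥⇒injection p (λ w → adj G u w ∧ adj G v w) p≤c in
  u , v , adj⇒≢ G Guv , Guv , w , (λ k l → w-inj) , λ k →
    let Guw , Gvw = ∧-true (common-w k) in
    (adj⇒≢ G Guw ∘ sym) , (adj⇒≢ G Gvw ∘ sym) , Guw , Gvw

module _ {p : ℕ} {G H : SimpleGraph (p + 5)} (G~H : Complementary G H) where

  bookFree⇒spread : ¬ ContainsBook p G → Spread 4 H
  bookFree⇒spread G-free u v u≢v Huv with 4 ≤? count (λ w → adj H u w ∨ adj H v w)
  ... | yes 4≤d = 4≤d
  ... | no  4≰d = ⊥-elim (G-free (commonNeighbours⇒containsBook p G Guv (+-cancelʳ-≤ 5 p c (begin
    p + 5        ≡⟨ commonNeighbours+jointComplementNeighbours {G = G} {H} G~H Guv ⟨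
    c + d + 2    ≤⟨ +-monoˡ-≤ 2 (+-monoʳ-≤ c (≤-pred (≰⇒> 4≰d))) ⟩
    c + 3 + 2    ≡⟨ +-assoc c 3 2 ⟩
    c + 5        ∎))))
    where
    open ≤-Reasoning
    Guv : adj G u v ≡ true
    Guv = trans (complementary-sym {G = G} {H} G~H u v u≢v) (cong not Huv)
    c = count (λ w → adj G u w ∧ adj G v w)
    d = count (λ w → adj H u w ∨ adj H v w)

  spread⇒bookFree : Spread 4 H → ¬ ContainsBook p G
  spread⇒bookFree spread (u , v , u≢v , Guv , w , w-inj , pages) = <-irrefl refl (begin-strict
    p + 5        <⟨ +-monoʳ-< p (s≤s ≤-refl) ⟩
    p + 6        ≡⟨ +-assoc p 4 2 ⟨
    p + 4 + 2    ≤⟨ +-monoˡ-≤ 2 (+-mono-≤ p≤c 4≤d) ⟩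
    c + d + 2    ≡⟨ commonNeighbours+jointComplementNeighbours {G = G} {H} G~H Guv ⟩
    p + 5        ∎)
    where
    open ≤-Reasoning
    c = count (λ x → adj G u x ∧ adj G v x)
    d = count (λ x → adj H u x ∨ adj H v x)
    p≤c : p ≤ c
    p≤c = ≤-count _ w (w-inj _ _) λ k → let _ , _ , Guw , Gvw = pages k in cong₂ _∧_ Guw Gvw
    4≤d : 4 ≤ d
    4≤d = spread u v u≢v (trans (G~H u v u≢v) (cong not Guv))

module _ {n : ℕ} (H : SimpleGraph n) where

  triangle : Fin n → Fin n → Fin n → Bool
  triangle x y z = adj H x y ∧ adj H x z ∧ adj H y z

  trianglesAt : Fin n → ℕ
  trianglesAt x = ∑[ y < n ] ∑[ z < n ] 𝟙 (y ≺ z ∧ triangle x y z)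

  triangleCount : ℕ
  triangleCount = ∑∑∑ λ x y z → 𝟙 (x ≺ y ∧ y ≺ z ∧ triangle x y z)

  triangle-swap : ∀ x y z → triangle x y z ≡ triangle y x z
  triangle-swap x y z rewrite SimpleGraph.sym H y x with adj H x y | adj H x z | adj H y z
  ... | true  | true  | true  = refl
  ... | true  | true  | false = refl
  ... | true  | false | true  = refl
  ... | true  | false | false = refl
  ... | false | _     | _     = refl

  triangle-rotate : ∀ x y z → triangle x y z ≡ triangle y z x
  triangle-rotate x y z rewrite SimpleGraph.sym H y x | SimpleGraph.sym H z x
    with adj H x y | adj H x z | adj H y z
  ... | true  | true  | true  = refl
  ... | true  | true  | false = refl
  ... | true  | false | c     = sym (∧-zeroʳ c)
  ... | false | true  | true  = refl
  ... | false | true  | false = refl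
  ... | false | false | c     = sym (∧-zeroʳ c)

  triangle⇒adj : ∀ {x y z} → triangle x y z ≡ true →
                 adj H x y ≡ true × adj H x z ≡ true × adj H y z ≡ true
  triangle⇒adj {x} {y} {z} T with adj H x y | adj H x z | adj H y z
  triangle⇒adj refl | true | true | true = refl , refl , refl

  -- Each triangle x < y < z is counted once in trianglesAt of each of its corners.
  ∑-trianglesAt : sum trianglesAt ≡ 3 * triangleCount
  ∑-trianglesAt = begin
    sum trianglesAt
      ≡⟨ sum-cong-≗ (λ x → sum-cong-≗ (λ y → sum-cong-≗ (split x y))) ⟩
    ∑∑∑ (λ x y z → before x y z + between x y z + after x y z)
      ≡⟨ ∑∑∑-distrib-+ (λ x y z → before x y z + between x y z) after ⟩
    ∑∑∑ (λ x y z → before x y z + between x y z) + ∑∑∑ after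
      ≡⟨ cong (_+ ∑∑∑ after) (∑∑∑-distrib-+ before between) ⟩
    triangleCount + ∑∑∑ between + ∑∑∑ after
      ≡⟨ cong₂ (λ s t → triangleCount + s + t) between≡ after≡ ⟩
    triangleCount + triangleCount + triangleCount
      ≡⟨ 3*m≡m+m+m triangleCount ⟨
    3 * triangleCount ∎
    where
    open ≡-Reasoning
    before between after : Fin n → Fin n → Fin n → ℕ
    before  x y z = 𝟙 (x ≺ y ∧ y ≺ z ∧ triangle x y z)
    between x y z = 𝟙 (y ≺ x ∧ x ≺ z ∧ triangle x y z)
    after   x y z = 𝟙 (y ≺ z ∧ z ≺ x ∧ triangle x y z)
    split : ∀ x y z → 𝟙 (y ≺ z ∧ triangle x y z) ≡ before x y z + between x y z + after x y z
    split x y z with triangle x y z in T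
    ... | false rewrite ∧-zeroʳ (z ≺ x) | ∧-zeroʳ (x ≺ z) | ∧-zeroʳ (y ≺ z) | ∧-zeroʳ (x ≺ y) | ∧-zeroʳ (y ≺ x) = refl
    ... | true rewrite ∧-identityʳ (y ≺ z) | ∧-identityʳ (x ≺ z) | ∧-identityʳ (z ≺ x) =
      let Hxy , Hxz , Hyz = triangle⇒adj T in
      <ᵇ-trichotomy (adj⇒≢ H Hxy ∘ Finₚ.toℕ-injective) (adj⇒≢ H Hxz ∘ Finₚ.toℕ-injective)
                    (adj⇒≢ H Hyz ∘ Finₚ.toℕ-injective)
    between≡ : ∑∑∑ between ≡ triangleCount
    between≡ = trans (∑-comm (λ x y → ∑[ z < n ] between x y z))
      (sum-cong-≗ λ y → sum-cong-≗ λ x → sum-cong-≗ λ z → cong (λ b → 𝟙 (y ≺ x ∧ x ≺ z ∧ b)) (triangle-swap x y z))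
    after≡ : ∑∑∑ after ≡ triangleCount
    after≡ = trans (∑-comm (λ x y → ∑[ z < n ] after x y z))
      (sum-cong-≗ λ y → trans (∑-comm (λ x z → after x y z))
        (sum-cong-≗ λ z → sum-cong-≗ λ x → cong (λ b → 𝟙 (y ≺ z ∧ z ≺ x ∧ b)) (triangle-rotate x y z)))

  triangle-swapʳ : ∀ x y z → triangle x y z ≡ triangle x z y
  triangle-swapʳ x y z = trans (triangle-rotate x y z) (trans (triangle-rotate y z x) (triangle-swap z x y))

  UniqueTriangle : Fin n → Set
  UniqueTriangle x = Σ (Fin n) λ a → Σ (Fin n) λ b → triangle x a b ≡ true ×
    (∀ y z → triangle x y z ≡ true → (y ≡ a × z ≡ b) ⊎ (y ≡ b × z ≡ a))

  private
    pairsFrom-partner : ∀ {x y c} → triangle x y c ≡ true → (∀ z → triangle x y z ≡ true → z ≡ c) →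
                        count (λ z → y ≺ z ∧ triangle x y z) ≡ 𝟙 (y ≺ c)
    pairsFrom-partner {x} {y} {c} Txyc unique
      rewrite count-single (λ z → y ≺ z ∧ triangle x y z) c (λ z yz → unique z (proj₂ (∧-true {y ≺ z} yz)))
            | Txyc = cong 𝟙 (∧-identityʳ (y ≺ c))

  -- Only y = a (with z = b) and y = b (with z = a) contribute to trianglesAt x.
  trianglesAt-row : ∀ {x} → (T : UniqueTriangle x) → let a , b , _ = T in ∀ y →
    count (λ z → y ≺ z ∧ triangle x y z) ≡ 𝟙 (y == a) * 𝟙 (a ≺ b) + 𝟙 (y == b) * 𝟙 (b ≺ a)
  trianglesAt-row {x} (a , b , Txab , only-ab) y with y ≟ a | y ≟ b
  ... | yes refl | yes refl = ⊥-elim (adj⇒≢ H (proj₂ (proj₂ (triangle⇒adj Txab))) refl)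
  ... | yes refl | no y≢b =
    trans (pairsFrom-partner Txab λ z T → [ proj₂ , (λ (a≡b , _) → ⊥-elim (y≢b a≡b)) ]′ (only-ab a z T))
          (sym (trans (+-identityʳ _) (+-identityʳ _)))
  ... | no y≢a | yes refl =
    trans (pairsFrom-partner (trans (triangle-swapʳ x b a) Txab)
             λ z T → [ (λ (b≡a , _) → ⊥-elim (y≢a b≡a)) , proj₂ ]′ (only-ab b z T))
          (sym (+-identityʳ _))
  ... | no y≢a | no y≢b = trans (sum-cong-≗ none) (sum-replicate-zero n)
    where
    none : ∀ z → 𝟙 (y ≺ z ∧ triangle x y z) ≡ 0
    none z with triangle x y z in T
    ... | true  = ⊥-elim ([ y≢a ∘ proj₁ , y≢b ∘ proj₁ ]′ (only-ab y z T))
    ... | false = cong 𝟙 (∧-zeroʳ (y ≺ z))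

  trianglesAt≡1 : ∀ {x} → UniqueTriangle x → trianglesAt x ≡ 1
  trianglesAt≡1 {x} T@(a , b , Txab , _) = begin
    trianglesAt x
      ≡⟨ sum-cong-≗ (trianglesAt-row T) ⟩
    ∑[ y < n ] (𝟙 (y == a) * 𝟙 (a ≺ b) + 𝟙 (y == b) * 𝟙 (b ≺ a))
      ≡⟨ ∑-distrib-+ (λ y → 𝟙 (y == a) * 𝟙 (a ≺ b)) (λ y → 𝟙 (y == b) * 𝟙 (b ≺ a)) ⟩
    ∑[ y < n ] (𝟙 (y == a) * 𝟙 (a ≺ b)) + ∑[ y < n ] (𝟙 (y == b) * 𝟙 (b ≺ a))
      ≡⟨ cong₂ _+_ (∑-point a (𝟙 (a ≺ b))) (∑-point b (𝟙 (b ≺ a))) ⟩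
    𝟙 (a ≺ b) + 𝟙 (b ≺ a)
      ≡⟨ ≺-connex (adj⇒≢ H (proj₂ (proj₂ (triangle⇒adj Txab)))) ⟩
    1 ∎
    where open ≡-Reasoning

module _ {n : ℕ} {H : SimpleGraph n} (spread : Spread 4 H) where

  spread⇒4≤degree+degree : ∀ {u v} → u ≢ v → adj H u v ≡ false → 4 ≤ degree H u + degree H v
  spread⇒4≤degree+degree {u} {v} u≢v Huv = begin
    4                                                       ≤⟨ spread u v u≢v Huv ⟩
    count (λ w → adj H u w ∨ adj H v w)                     ≤⟨ m≤m+n _ _ ⟩
    count (λ w → adj H u w ∨ adj H v w) + count (λ w → adj H u w ∧ adj H v w)
                                                            ≡⟨ count-∨+∧ (adj H u) (adj H v) ⟩
    degree H u + degree H v                                 ∎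
    where open ≤-Reasoning

  -- The neighbours of u have degree ≥ 1 and, when degree H u ≤ 1, its non-neighbours have degree ≥ 3.
  lowDegree⇒3n≤degreeSum+4 : ∀ {u} → degree H u ≤ 1 → 3 * n ≤ sum (degree H) + 4
  lowDegree⇒3n≤degreeSum+4 {u} d≤1 = begin
    3 * n
      ≡⟨ cong (3 *_) (degree-complementary {G = H} {H̄} (complement-complementary H) u) ⟨
    3 * (d + c + 1)                                ≡⟨ rearrange d c ⟩
    3 * c + d + d * 1 + 3 + d                      ≤⟨ +-monoʳ-≤ (3 * c + d + d * 1 + 3) d≤1 ⟩
    3 * c + d + d * 1 + 3 + 1                      ≡⟨ +-assoc (3 * c + d + d * 1) 3 1 ⟩
    3 * c + d + d * 1 + 4                          ≡⟨ cong (_+ 4) lowerSum ⟨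
    sum (λ v → 3 * 𝟙 (adj H̄ u v) + 𝟙 (adj H u v) + d * 𝟙 (v == u)) + 4
                                                   ≤⟨ +-monoˡ-≤ 4 (∑-mono-≤ pointwise) ⟩
    sum (degree H) + 4                             ∎
    where
    open ≤-Reasoning
    H̄ = complement H
    d = degree H u
    c = degree H̄ u
    rearrange : ∀ d c → 3 * (d + c + 1) ≡ 3 * c + d + d * 1 + 3 + d
    rearrange = solve-∀
    lowerSum : sum (λ v → 3 * 𝟙 (adj H̄ u v) + 𝟙 (adj H u v) + d * 𝟙 (v == u)) ≡ 3 * c + d + d * 1
    lowerSum = trans (∑-distrib-+ (λ v → 3 * 𝟙 (adj H̄ u v) + 𝟙 (adj H u v)) (λ v → d * 𝟙 (v == u)))
      (cong₂ _+_ (trans (∑-distrib-+ (λ v → 3 * 𝟙 (adj H̄ u v)) (𝟙 ∘ adj H u))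
                        (cong (_+ d) (sym (*-distribˡ-sum 3 (𝟙 ∘ adj H̄ u)))))
                 (trans (sym (*-distribˡ-sum d (𝟙 ∘ (_== u)))) (cong (d *_) (count-point u))))
    pointwise : ∀ v → 3 * 𝟙 (adj H̄ u v) + 𝟙 (adj H u v) + d * 𝟙 (v == u) ≤ degree H v
    pointwise v with v ≟ u
    ... | yes refl rewrite irrefl H̄ v | irrefl H v = ≤-reflexive (*-identityʳ d)
    ... | no v≢u rewrite complement-complementary H u v (v≢u ∘ sym) | *-zeroʳ d with adj H u v in Huv
    ...   | true  = count≥1 (adj H v) (trans (SimpleGraph.sym H v u) Huv)
    ...   | false = +-cancelˡ-≤ d 3 (degree H v) (begin
      d + 3              ≤⟨ +-monoˡ-≤ 3 d≤1 ⟩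
      4                  ≤⟨ spread⇒4≤degree+degree (v≢u ∘ sym) Huv ⟩
      d + degree H v     ∎)

three-neighbours⇒3≤degree : ∀ {n} (H : SimpleGraph n) {x a b c} → a ≢ b → a ≢ c → b ≢ c →
  adj H x a ≡ true → adj H x b ≡ true → adj H x c ≡ true → 3 ≤ degree H x
three-neighbours⇒3≤degree H a≢b a≢c b≢c Hxa Hxb Hxc =
  ≤-count (adj H _) (_ ∷ _ ∷ _ ∷ [])
    (triple-injective a≢b a≢c b≢c)
    λ { zero → Hxa ; (suc zero) → Hxb ; (suc (suc zero)) → Hxc }

module _ {n : ℕ} {H : SimpleGraph n} (spread : Spread 4 H)
         (2≤degree : ∀ v → 2 ≤ degree H v) (sparse : sum (degree H) ≤ 2 * n + 2) where

  Light Heavy : Fin n → Set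
  Light v = degree H v ≡ 2
  Heavy v = 3 ≤ degree H v

  light-or-heavy : ∀ v → Light v ⊎ Heavy v
  light-or-heavy v with degree H v ≤? 2
  ... | yes d≤2 = inj₁ (≤-antisym d≤2 (2≤degree v))
  ... | no  d≰2 = inj₂ (≰⇒> d≰2)

  light⇒¬3≤degree : ∀ {y} → Light y → ¬ 3 ≤ degree H y
  light⇒¬3≤degree light 3≤d with ≤-trans 3≤d (≤-reflexive light)
  ... | s≤s (s≤s ())

  light≢heavy : ∀ {y z} → Light y → Heavy z → y ≢ z
  light≢heavy light heavy refl = light⇒¬3≤degree light heavy

  excess : Fin n → ℕ
  excess v = degree H v ∸ 2

  ∑excess≤2 : sum excess ≤ 2
  ∑excess≤2 = +-cancelˡ-≤ (2 * n) (sum excess) 2 (begin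
    2 * n + sum excess           ≡⟨ cong (_+ sum excess) (trans (*-comm 2 n) (sym (∑-const n 2))) ⟩
    ∑[ v < n ] 2 + sum excess    ≡⟨ ∑-distrib-+ (λ _ → 2) excess ⟨
    sum (λ v → 2 + excess v)     ≡⟨ sum-cong-≗ (λ v → m+[n∸m]≡n (2≤degree v)) ⟩
    sum (degree H)               ≤⟨ sparse ⟩
    2 * n + 2                    ∎)
    where open ≤-Reasoning

  heavy⇒1≤excess : ∀ {v} → Heavy v → 1 ≤ excess v
  heavy⇒1≤excess heavy = ∸-monoˡ-≤ 2 heavy

  excess-distinct≤2 : ∀ {k} (w : Fin k → Fin n) → Injective _≡_ _≡_ w → sum (excess ∘ w) ≤ 2
  excess-distinct≤2 w w-inj = ≤-trans (∑-∘-injective-≤ excess w w-inj) ∑excess≤2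

  heavyPair⇒degree≡3 : ∀ {x y} → x ≢ y → Heavy x → Heavy y → degree H x ≡ 3
  heavyPair⇒degree≡3 {x} {y} x≢y heavy-x heavy-y =
    trans (sym (m+[n∸m]≡n (2≤degree x))) (cong (2 +_) (≤-antisym excess-x≤1 (heavy⇒1≤excess heavy-x)))
    where
    excess-x≤1 : excess x ≤ 1
    excess-x≤1 = +-cancelʳ-≤ 1 (excess x) 1 (begin
      excess x + 1               ≤⟨ +-monoʳ-≤ (excess x) (heavy⇒1≤excess heavy-y) ⟩
      excess x + excess y        ≡⟨ cong (excess x +_) (+-identityʳ (excess y)) ⟨
      excess x + (excess y + 0)  ≤⟨ excess-distinct≤2 (x ∷ y ∷ []) (pair-injective x≢y) ⟩
      2                          ∎)
      where open ≤-Reasoning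

  ¬heavyTriple : ∀ {x y z} → x ≢ y → x ≢ z → y ≢ z → Heavy x → Heavy y → Heavy z → ⊥
  ¬heavyTriple {x} {y} {z} x≢y x≢z y≢z heavy-x heavy-y heavy-z = <-irrefl refl (begin-strict
    2                                       <⟨ +-mono-≤ (heavy⇒1≤excess heavy-x)
                                                 (+-mono-≤ (heavy⇒1≤excess heavy-y) (+-monoˡ-≤ 0 (heavy⇒1≤excess heavy-z))) ⟩
    excess x + (excess y + (excess z + 0))  ≤⟨ excess-distinct≤2 (x ∷ y ∷ z ∷ []) (triple-injective x≢y x≢z y≢z) ⟩
    2                                       ∎)
    where open ≤-Reasoning

  -- Two non-adjacent light vertices have 2 + 2 neighbours, so by Spread they share none.
  lightPair-adjacent : ∀ {x y y′} → y ≢ y′ → Light y → Light y′ →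
                       adj H x y ≡ true → adj H x y′ ≡ true → adj H y y′ ≡ true
  lightPair-adjacent {x} {y} {y′} y≢y′ light light′ Hxy Hxy′ with adj H y y′ in Hyy′
  ... | true  = refl
  ... | false = ⊥-elim (<-irrefl refl (begin-strict
    4                       <⟨ +-monoʳ-≤ 4 (count≥1 (λ w → adj H y w ∧ adj H y′ w) x-common) ⟩
    4 + count common        ≤⟨ +-monoˡ-≤ (count common) (spread y y′ y≢y′ Hyy′) ⟩
    count joint + count common ≡⟨ count-∨+∧ (adj H y) (adj H y′) ⟩
    degree H y + degree H y′   ≡⟨ cong₂ _+_ light light′ ⟩
    4                       ∎))
    where
    open ≤-Reasoning
    common joint : Fin n → Bool
    common w = adj H y w ∧ adj H y′ w
    joint  w = adj H y w ∨ adj H y′ w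
    x-common : common x ≡ true
    x-common rewrite SimpleGraph.sym H y x | SimpleGraph.sym H y′ x | Hxy | Hxy′ = refl

  record HeavyNeighbourhood (z : Fin n) : Set where
    field
      y₁ y₂ z′ : Fin n
      light₁   : Light y₁
      light₂   : Light y₂
      heavy′   : Heavy z′
      zy₁      : adj H z y₁ ≡ true
      zy₂      : adj H z y₂ ≡ true
      zz′      : adj H z z′ ≡ true
      y₁y₂     : adj H y₁ y₂ ≡ true
      only     : ∀ j → adj H z j ≡ true → j ≡ y₁ ⊎ j ≡ y₂ ⊎ j ≡ z′

  private
    heavyNeighbourhood′ : ∀ {z a b c} → Heavy z → a ≢ b → a ≢ c → b ≢ c → Light a → Light b → Heavy c →
      adj H z a ≡ true → adj H z b ≡ true → adj H z c ≡ true → HeavyNeighbourhood z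
    heavyNeighbourhood′ {z} {a} {b} {c} heavy-z a≢b a≢c b≢c light-a light-b heavy-c Hza Hzb Hzc = record
      { y₁ = a ; y₂ = b ; z′ = c ; light₁ = light-a ; light₂ = light-b ; heavy′ = heavy-c
      ; zy₁ = Hza ; zy₂ = Hzb ; zz′ = Hzc ; y₁y₂ = lightPair-adjacent a≢b light-a light-b Hza Hzb
      ; only = λ j Hzj → case-of-three (count≡⇒surjective (adj H z) (a ∷ b ∷ c ∷ []) (triple-injective a≢b a≢c b≢c)
                            (λ { zero → Hza ; (suc zero) → Hzb ; (suc (suc zero)) → Hzc })
                            (heavyPair⇒degree≡3 (adj⇒≢ H Hzc) heavy-z heavy-c) j Hzj)
      }
      where
      case-of-three : ∀ {j} → ∃ (λ i → (a ∷ b ∷ c ∷ []) i ≡ j) → j ≡ a ⊎ j ≡ b ⊎ j ≡ c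
      case-of-three (zero , a≡j)                = inj₁ (sym a≡j)
      case-of-three (suc zero , b≡j)            = inj₂ (inj₁ (sym b≡j))
      case-of-three (suc (suc zero) , c≡j)      = inj₂ (inj₂ (sym c≡j))

  -- Of three neighbours of a heavy z, not all are light (the first would get a third neighbour) and no
  -- two are heavy (no heavy triple); so exactly one is heavy, which forces degree H z ≡ 3.
  heavyNeighbourhood : ∀ {z} → Heavy z → HeavyNeighbourhood z
  heavyNeighbourhood {z} heavy-z with count≥⇒injection 3 (adj H z) heavy-z
  ... | w , w-inj , Hzw = classify (light-or-heavy a) (light-or-heavy b) (light-or-heavy c)
    where
    a = w zero
    b = w (suc zero)
    c = w (suc (suc zero))
    Hza = Hzw zero
    Hzb = Hzw (suc zero)
    Hzc = Hzw (suc (suc zero))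
    a≢b : a ≢ b
    a≢b = (λ ()) ∘ w-inj
    a≢c : a ≢ c
    a≢c = (λ ()) ∘ w-inj
    b≢c : b ≢ c
    b≢c = (λ ()) ∘ w-inj
    z≢ : ∀ {v} → adj H z v ≡ true → z ≢ v
    z≢ = adj⇒≢ H
    classify : Light a ⊎ Heavy a → Light b ⊎ Heavy b → Light c ⊎ Heavy c → HeavyNeighbourhood z
    classify (inj₁ la) (inj₁ lb) (inj₁ lc) = ⊥-elim (light⇒¬3≤degree la
      (three-neighbours⇒3≤degree H (z≢ Hzb) (z≢ Hzc) b≢c (trans (SimpleGraph.sym H a z) Hza)
        (lightPair-adjacent a≢b la lb Hza Hzb) (lightPair-adjacent a≢c la lc Hza Hzc)))
    classify (inj₁ la) (inj₁ lb) (inj₂ hc) = heavyNeighbourhood′ heavy-z a≢b a≢c b≢c la lb hc Hza Hzb Hzc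
    classify (inj₁ la) (inj₂ hb) (inj₁ lc) = heavyNeighbourhood′ heavy-z a≢c a≢b (b≢c ∘ sym) la lc hb Hza Hzc Hzb
    classify (inj₂ ha) (inj₁ lb) (inj₁ lc) =
      heavyNeighbourhood′ heavy-z b≢c (a≢b ∘ sym) (a≢c ∘ sym) lb lc ha Hzb Hzc Hza
    classify (inj₂ ha) (inj₂ hb) _         = ⊥-elim (¬heavyTriple (z≢ Hza) (z≢ Hzb) a≢b heavy-z ha hb)
    classify (inj₂ ha) (inj₁ _)  (inj₂ hc) = ⊥-elim (¬heavyTriple (z≢ Hza) (z≢ Hzc) a≢c heavy-z ha hc)
    classify (inj₁ _)  (inj₂ hb) (inj₂ hc) = ⊥-elim (¬heavyTriple (z≢ Hzb) (z≢ Hzc) b≢c heavy-z hb hc)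

  heavy⇒uniqueTriangle : ∀ {x} → Heavy x → UniqueTriangle H x
  heavy⇒uniqueTriangle {x} heavy-x = y₁ , y₂ , T , closure
    where
    open HeavyNeighbourhood (heavyNeighbourhood heavy-x)
    T : triangle H x y₁ y₂ ≡ true
    T rewrite zy₁ | zy₂ | y₁y₂ = refl
    y₁≁z′ : adj H y₁ z′ ≡ true → ⊥
    y₁≁z′ H₁z′ = light⇒¬3≤degree light₁ (three-neighbours⇒3≤degree H
      (adj⇒≢ H zy₂) (adj⇒≢ H zz′) (light≢heavy light₂ heavy′)
      (trans (SimpleGraph.sym H y₁ x) zy₁) y₁y₂ H₁z′)
    y₂≁z′ : adj H y₂ z′ ≡ true → ⊥
    y₂≁z′ H₂z′ = light⇒¬3≤degree light₂ (three-neighbours⇒3≤degree H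
      (adj⇒≢ H zy₁) (adj⇒≢ H zz′) (light≢heavy light₁ heavy′)
      (trans (SimpleGraph.sym H y₂ x) zy₂) (trans (SimpleGraph.sym H y₂ y₁) y₁y₂) H₂z′)
    loop : ∀ {v} → adj H v v ≡ true → ⊥
    loop Hvv = adj⇒≢ H Hvv refl
    closure : ∀ y z → triangle H x y z ≡ true → (y ≡ y₁ × z ≡ y₂) ⊎ (y ≡ y₂ × z ≡ y₁)
    closure y z Txyz with triangle⇒adj H Txyz
    ... | Hxy , Hxz , Hyz with only y Hxy | only z Hxz
    ... | inj₁ refl        | inj₁ refl        = ⊥-elim (loop Hyz)
    ... | inj₁ refl        | inj₂ (inj₁ refl) = inj₁ (refl , refl)
    ... | inj₁ refl        | inj₂ (inj₂ refl) = ⊥-elim (y₁≁z′ Hyz)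
    ... | inj₂ (inj₁ refl) | inj₁ refl        = inj₂ (refl , refl)
    ... | inj₂ (inj₁ refl) | inj₂ (inj₁ refl) = ⊥-elim (loop Hyz)
    ... | inj₂ (inj₁ refl) | inj₂ (inj₂ refl) = ⊥-elim (y₂≁z′ Hyz)
    ... | inj₂ (inj₂ refl) | inj₁ refl        = ⊥-elim (y₁≁z′ (trans (SimpleGraph.sym H y₁ y) Hyz))
    ... | inj₂ (inj₂ refl) | inj₂ (inj₁ refl) = ⊥-elim (y₂≁z′ (trans (SimpleGraph.sym H y₂ y) Hyz))
    ... | inj₂ (inj₂ refl) | inj₂ (inj₂ refl) = ⊥-elim (loop Hyz)

  light⇒neighbours : ∀ {x} → Light x → Σ (Fin n) λ a → Σ (Fin n) λ b → a ≢ b ×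
    adj H x a ≡ true × adj H x b ≡ true × (∀ j → adj H x j ≡ true → j ≡ a ⊎ j ≡ b)
  light⇒neighbours {x} light with count≥⇒injection 2 (adj H x) (≤-reflexive (sym light))
  ... | w , w-inj , Hxw = a , b , a≢b , Hxw zero , Hxw (suc zero) , only
    where
    a = w zero
    b = w (suc zero)
    a≢b : a ≢ b
    a≢b = (λ ()) ∘ w-inj
    only : ∀ j → adj H x j ≡ true → j ≡ a ⊎ j ≡ b
    only j Hxj with count≡⇒surjective (adj H x) (a ∷ b ∷ [])
                      (pair-injective a≢b)
                      (λ { zero → Hxw zero ; (suc zero) → Hxw (suc zero) }) light j Hxj
    ... | zero , a≡j     = inj₁ (sym a≡j)
    ... | suc zero , b≡j = inj₂ (sym b≡j)

  -- A light x is y₁ or y₂ in the heavy neighbourhood of a, so its other neighbour b is the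
  -- remaining light vertex there, a neighbour of a.
  lightHeavy-partner : ∀ {x a b} → Light x → Heavy a → adj H x a ≡ true →
    (∀ j → adj H x j ≡ true → j ≡ a ⊎ j ≡ b) → adj H a b ≡ true
  lightHeavy-partner {x} {a} {b} light-x heavy-a Hxa only-x =
    partner (only x (trans (SimpleGraph.sym H a x) Hxa))
    where
    open HeavyNeighbourhood (heavyNeighbourhood heavy-a)
    light-neighbour≡b : ∀ {y} → Light y → adj H x y ≡ true → y ≡ b
    light-neighbour≡b light-y Hxy = [ ⊥-elim ∘ light≢heavy light-y heavy-a , id ]′ (only-x _ Hxy)
    a~ : ∀ {y} → adj H a y ≡ true → y ≡ b → adj H a b ≡ true
    a~ Hay refl = Hay
    partner : x ≡ y₁ ⊎ x ≡ y₂ ⊎ x ≡ z′ → adj H a b ≡ true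
    partner (inj₁ x≡y₁) =
      a~ zy₂ (light-neighbour≡b light₂ (subst (λ v → adj H v y₂ ≡ true) (sym x≡y₁) y₁y₂))
    partner (inj₂ (inj₁ x≡y₂)) =
      a~ zy₁ (light-neighbour≡b light₁
        (subst (λ v → adj H v y₁ ≡ true) (sym x≡y₂) (trans (SimpleGraph.sym H y₂ y₁) y₁y₂)))
    partner (inj₂ (inj₂ x≡z′)) = ⊥-elim (light≢heavy light-x heavy′ x≡z′)

  light⇒uniqueTriangle : ∀ {x} → Light x → UniqueTriangle H x
  light⇒uniqueTriangle {x} light-x with light⇒neighbours light-x
  ... | a , b , a≢b , Hxa , Hxb , only-x = a , b , T , closure
    where
    only-x′ : ∀ j → adj H x j ≡ true → j ≡ b ⊎ j ≡ a
    only-x′ j Hxj = [ inj₂ , inj₁ ]′ (only-x j Hxj)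
    Hab : adj H a b ≡ true
    Hab with light-or-heavy a | light-or-heavy b
    ... | inj₂ heavy-a | _            = lightHeavy-partner light-x heavy-a Hxa only-x
    ... | inj₁ _       | inj₂ heavy-b = trans (SimpleGraph.sym H a b) (lightHeavy-partner light-x heavy-b Hxb only-x′)
    ... | inj₁ light-a | inj₁ light-b = lightPair-adjacent a≢b light-a light-b Hxa Hxb
    T : triangle H x a b ≡ true
    T rewrite Hxa | Hxb | Hab = refl
    closure : ∀ y z → triangle H x y z ≡ true → (y ≡ a × z ≡ b) ⊎ (y ≡ b × z ≡ a)
    closure y z Txyz with triangle⇒adj H Txyz
    ... | Hxy , Hxz , Hyz with only-x y Hxy | only-x z Hxz
    ... | inj₁ refl | inj₁ refl = ⊥-elim (adj⇒≢ H Hyz refl)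
    ... | inj₁ refl | inj₂ refl = inj₁ (refl , refl)
    ... | inj₂ refl | inj₁ refl = inj₂ (refl , refl)
    ... | inj₂ refl | inj₂ refl = ⊥-elim (adj⇒≢ H Hyz refl)

  uniqueTriangle : ∀ x → UniqueTriangle H x
  uniqueTriangle x = [ light⇒uniqueTriangle , heavy⇒uniqueTriangle ]′ (light-or-heavy x)

  sparse⇒n≡3*triangleCount : n ≡ 3 * triangleCount H
  sparse⇒n≡3*triangleCount = begin
    n                    ≡⟨ ∑-1 n ⟨
    ∑[ x < n ] 1         ≡⟨ sum-cong-≗ (trianglesAt≡1 H ∘ uniqueTriangle) ⟨
    sum (trianglesAt H)  ≡⟨ ∑-trianglesAt H ⟩
    3 * triangleCount H  ∎
    where open ≡-Reasoning

module _ {n : ℕ} {H : SimpleGraph n} (spread : Spread 4 H) where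

  spread⇒n≤edgeCount : 4 ≤ n → n ≤ edgeCount H
  spread⇒n≤edgeCount 4≤n = m+m≤n+n⇒m≤n (subst (n + n ≤_) (sym (handshake H)) n+n≤∑degree)
    where
    n+n≤∑degree : n + n ≤ sum (degree H)
    n+n≤∑degree with Finₚ.any? (λ u → degree H u ≤? 1)
    ... | yes (u , d≤1) = +-cancelʳ-≤ 4 (n + n) (sum (degree H)) (begin
      n + n + 4             ≤⟨ +-monoʳ-≤ (n + n) 4≤n ⟩
      n + n + n             ≡⟨ 3*m≡m+m+m n ⟨
      3 * n                 ≤⟨ lowDegree⇒3n≤degreeSum+4 {H = H} spread d≤1 ⟩
      sum (degree H) + 4    ∎)
      where open ≤-Reasoning
    ... | no  ¬low = begin
      n + n                 ≡⟨ cong (n +_) (+-identityʳ n) ⟨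
      2 * n                 ≡⟨ trans (*-comm 2 n) (sym (∑-const n 2)) ⟩
      ∑[ u < n ] 2          ≤⟨ ∑-mono-≤ (λ u → ≰⇒> (¬low ∘ (u ,_))) ⟩
      sum (degree H)        ∎
      where open ≤-Reasoning

  -- If e(H) ≤ n + 1 and no degree is ≤ 1, every vertex lies on exactly one triangle of H, so 3 ∣ n.
  spread⇒n+2≤edgeCount : 7 ≤ n → ¬ 3 ∣ n → n + 2 ≤ edgeCount H
  spread⇒n+2≤edgeCount 7≤n 3∤n = subst (_≤ edgeCount H) (+-comm 2 n)
    (m+m<n+n⇒m<n (subst (suc n + suc n <_) (sym (handshake H)) n+n+2<∑degree))
    where
    n+n+2<∑degree : suc n + suc n < sum (degree H)
    n+n+2<∑degree with Finₚ.any? (λ u → degree H u ≤? 1)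
    ... | yes (u , d≤1) = +-cancelʳ-≤ 4 (suc (suc n + suc n)) (sum (degree H)) (begin
      suc (suc n + suc n) + 4 ≡⟨ rearrange n ⟩
      n + n + 7               ≤⟨ +-monoʳ-≤ (n + n) 7≤n ⟩
      n + n + n               ≡⟨ 3*m≡m+m+m n ⟨
      3 * n                   ≤⟨ lowDegree⇒3n≤degreeSum+4 {H = H} spread d≤1 ⟩
      sum (degree H) + 4      ∎)
      where
      open ≤-Reasoning
      rearrange : ∀ m → suc (suc m + suc m) + 4 ≡ m + m + 7
      rearrange = solve-∀
    ... | no  ¬low with sum (degree H) ≤? 2 * n + 2
    ...   | yes sparse = ⊥-elim (3∤n (divides (triangleCount H) (trans
              (sparse⇒n≡3*triangleCount {H = H} spread (λ u → ≰⇒> (¬low ∘ (u ,_))) sparse)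
              (*-comm 3 (triangleCount H)))))
    ...   | no  ¬sparse = ≤-trans (≤-reflexive (cong suc (rearrange n))) (≰⇒> ¬sparse)
      where
      rearrange : ∀ m → suc m + suc m ≡ 2 * m + 2
      rearrange = solve-∀

MinDegree : ∀ {n} → ℕ → SimpleGraph n → Set
MinDegree {n} k G = ∀ u → k ≤ degree G u

minDegree? : ∀ {n} k (G : SimpleGraph n) → Dec (MinDegree k G)
minDegree? k G = Finₚ.all? λ u → k ≤? degree G u

spread? : ∀ {n} k (H : SimpleGraph n) → Dec (Spread k H)
spread? k H = Finₚ.all? λ u → Finₚ.all? λ v →
  ¬? (u ≟ v) →-dec (adj H u v Boolₚ.≟ false) →-dec (k ≤? count (λ w → adj H u w ∨ adj H v w))

module _ {a b : ℕ} where

  data Side : Fin (a + b) → Set where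
    left  : ∀ i → Side (i ↑ˡ b)
    right : ∀ j → Side (a ↑ʳ j)

  side : ∀ v → Side v
  side v with splitAt a v in eq
  ... | inj₁ i = subst Side (Finₚ.splitAt⁻¹-↑ˡ eq) (left i)
  ... | inj₂ j = subst Side (Finₚ.splitAt⁻¹-↑ʳ eq) (right j)

  module _ (G : SimpleGraph a) (H : SimpleGraph b) where

    private
      sideAdj : Fin a ⊎ Fin b → Fin a ⊎ Fin b → Bool
      sideAdj (inj₁ i) (inj₁ j) = adj G i j
      sideAdj (inj₂ i) (inj₂ j) = adj H i j
      sideAdj _        _        = false

      sideAdj-sym : ∀ x y → sideAdj x y ≡ sideAdj y x
      sideAdj-sym (inj₁ i) (inj₁ j) = SimpleGraph.sym G i j
      sideAdj-sym (inj₁ i) (inj₂ j) = refl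
      sideAdj-sym (inj₂ i) (inj₁ j) = refl
      sideAdj-sym (inj₂ i) (inj₂ j) = SimpleGraph.sym H i j

      sideAdj-irrefl : ∀ x → sideAdj x x ≡ false
      sideAdj-irrefl (inj₁ i) = irrefl G i
      sideAdj-irrefl (inj₂ j) = irrefl H j

    infixr 5 _⊕_
    _⊕_ : SimpleGraph (a + b)
    _⊕_ = record
      { adj    = λ u v → sideAdj (splitAt a u) (splitAt a v)
      ; sym    = λ u v → sideAdj-sym (splitAt a u) (splitAt a v)
      ; irrefl = λ u → sideAdj-irrefl (splitAt a u)
      }

    ⊕-adj-ll : ∀ i j → adj _⊕_ (i ↑ˡ b) (j ↑ˡ b) ≡ adj G i j
    ⊕-adj-ll i j = cong₂ sideAdj (Finₚ.splitAt-↑ˡ a i b) (Finₚ.splitAt-↑ˡ a j b)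

    ⊕-adj-lr : ∀ i j → adj _⊕_ (i ↑ˡ b) (a ↑ʳ j) ≡ false
    ⊕-adj-lr i j = cong₂ sideAdj (Finₚ.splitAt-↑ˡ a i b) (Finₚ.splitAt-↑ʳ a b j)

    ⊕-adj-rl : ∀ i j → adj _⊕_ (a ↑ʳ i) (j ↑ˡ b) ≡ false
    ⊕-adj-rl i j = cong₂ sideAdj (Finₚ.splitAt-↑ʳ a b i) (Finₚ.splitAt-↑ˡ a j b)

    ⊕-adj-rr : ∀ i j → adj _⊕_ (a ↑ʳ i) (a ↑ʳ j) ≡ adj H i j
    ⊕-adj-rr i j = cong₂ sideAdj (Finₚ.splitAt-↑ʳ a b i) (Finₚ.splitAt-↑ʳ a b j)

    count-⊕ : ∀ P → count P ≡ count (P ∘ (_↑ˡ b)) + count (P ∘ (a ↑ʳ_))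
    count-⊕ P = ∑-↑ a (𝟙 ∘ P)

    degree-⊕ˡ : ∀ i → degree _⊕_ (i ↑ˡ b) ≡ degree G i
    degree-⊕ˡ i = begin
      degree _⊕_ (i ↑ˡ b)                                ≡⟨ count-⊕ (adj _⊕_ (i ↑ˡ b)) ⟩
      count (adj _⊕_ (i ↑ˡ b) ∘ (_↑ˡ b)) + count (adj _⊕_ (i ↑ˡ b) ∘ (a ↑ʳ_))
                                                         ≡⟨ cong₂ _+_ (count-cong (⊕-adj-ll i)) (count-cong (⊕-adj-lr i)) ⟩
      degree G i + count {b} (λ _ → false)               ≡⟨ cong (degree G i +_) (count-false b) ⟩
      degree G i + 0                                     ≡⟨ +-identityʳ _ ⟩
      degree G i                                         ∎
      where open ≡-Reasoning

    degree-⊕ʳ : ∀ j → degree _⊕_ (a ↑ʳ j) ≡ degree H j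
    degree-⊕ʳ j = begin
      degree _⊕_ (a ↑ʳ j)                                ≡⟨ count-⊕ (adj _⊕_ (a ↑ʳ j)) ⟩
      count (adj _⊕_ (a ↑ʳ j) ∘ (_↑ˡ b)) + count (adj _⊕_ (a ↑ʳ j) ∘ (a ↑ʳ_))
                                                         ≡⟨ cong₂ _+_ (count-cong (⊕-adj-rl j)) (count-cong (⊕-adj-rr j)) ⟩
      count {a} (λ _ → false) + degree H j               ≡⟨ cong (_+ degree H j) (count-false a) ⟩
      degree H j                                         ∎
      where open ≡-Reasoning

    ∑degree-⊕ : sum (degree _⊕_) ≡ sum (degree G) + sum (degree H)
    ∑degree-⊕ = trans (∑-↑ a (degree _⊕_)) (cong₂ _+_ (sum-cong-≗ degree-⊕ˡ) (sum-cong-≗ degree-⊕ʳ))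

    minDegree-⊕ : ∀ {k} → MinDegree k G → MinDegree k H → MinDegree k _⊕_
    minDegree-⊕ minG minH u with side u
    ... | left i  = subst (_ ≤_) (sym (degree-⊕ˡ i)) (minG i)
    ... | right j = subst (_ ≤_) (sym (degree-⊕ʳ j)) (minH j)

    -- Inside a part Spread is inherited; across the parts the two neighbourhoods are disjoint.
    spread-⊕ : Spread 4 G → Spread 4 H → MinDegree 2 G → MinDegree 2 H → Spread 4 _⊕_
    spread-⊕ spreadG spreadH minG minH u v = by-side (side u) (side v)
      where
      joint : Fin (a + b) → Fin (a + b) → Fin (a + b) → Bool
      joint u v w = adj _⊕_ u w ∨ adj _⊕_ v w
      open ≤-Reasoning
      by-side : ∀ {u v} → Side u → Side v → u ≢ v → adj _⊕_ u v ≡ false → 4 ≤ count (joint u v)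
      by-side {u} {v} (left i) (left j) u≢v Huv = begin
        4                                                       ≤⟨ spreadG i j (u≢v ∘ cong (_↑ˡ b)) (trans (sym (⊕-adj-ll i j)) Huv) ⟩
        count (λ w → adj G i w ∨ adj G j w)                     ≤⟨ m≤m+n _ _ ⟩
        count (λ w → adj G i w ∨ adj G j w) + count {b} (λ _ → false)
          ≡⟨ cong₂ _+_ (count-cong λ w → cong₂ _∨_ (⊕-adj-ll i w) (⊕-adj-ll j w))
                       (count-cong λ w → cong₂ _∨_ (⊕-adj-lr i w) (⊕-adj-lr j w)) ⟨
        count (joint u v ∘ (_↑ˡ b)) + count (joint u v ∘ (a ↑ʳ_))
          ≡⟨ count-⊕ (joint u v) ⟨
        count (joint u v) ∎
      by-side {u} {v} (left i) (right j) _ _ = begin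
        4                                                       ≤⟨ +-mono-≤ (minG i) (minH j) ⟩
        degree G i + degree H j
          ≡⟨ cong₂ _+_ (count-cong λ w → trans (cong₂ _∨_ (⊕-adj-ll i w) (⊕-adj-rl j w)) (∨-identityʳ _))
                       (count-cong λ w → cong₂ _∨_ (⊕-adj-lr i w) (⊕-adj-rr j w)) ⟨
        count (joint u v ∘ (_↑ˡ b)) + count (joint u v ∘ (a ↑ʳ_))
          ≡⟨ count-⊕ (joint u v) ⟨
        count (joint u v) ∎
      by-side {u} {v} (right i) (left j) _ _ = begin
        4                                                       ≤⟨ +-mono-≤ (minG j) (minH i) ⟩
        degree G j + degree H i
          ≡⟨ cong₂ _+_ (count-cong λ w → cong₂ _∨_ (⊕-adj-rl i w) (⊕-adj-ll j w))
                       (count-cong λ w → trans (cong₂ _∨_ (⊕-adj-rr i w) (⊕-adj-lr j w)) (∨-identityʳ _)) ⟨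
        count (joint u v ∘ (_↑ˡ b)) + count (joint u v ∘ (a ↑ʳ_))
          ≡⟨ count-⊕ (joint u v) ⟨
        count (joint u v) ∎
      by-side {u} {v} (right i) (right j) u≢v Huv = begin
        4                                                       ≤⟨ spreadH i j (u≢v ∘ cong (a ↑ʳ_)) (trans (sym (⊕-adj-rr i j)) Huv) ⟩
        count (λ w → adj H i w ∨ adj H j w)                     ≡⟨ cong (_+ _) (count-false a) ⟨
        count {a} (λ _ → false) + count (λ w → adj H i w ∨ adj H j w)
          ≡⟨ cong₂ _+_ (count-cong λ w → cong₂ _∨_ (⊕-adj-rl i w) (⊕-adj-rl j w))
                       (count-cong λ w → cong₂ _∨_ (⊕-adj-rr i w) (⊕-adj-rr j w)) ⟨
        count (joint u v ∘ (_↑ˡ b)) + count (joint u v ∘ (a ↑ʳ_))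
          ≡⟨ count-⊕ (joint u v) ⟨
        count (joint u v) ∎

complete : ∀ k → SimpleGraph k
complete k = record
  { adj    = λ u v → not (u == v)
  ; sym    = λ u v → cong not (==-sym u v)
  ; irrefl = λ u → cong not (==-refl u)
  }

triangles : ∀ m → SimpleGraph (m * 3)
triangles zero    = complete 0
triangles (suc m) = complete 3 ⊕ triangles m

minDegree-triangles : ∀ m → MinDegree 2 (triangles m)
minDegree-triangles zero    = λ ()
minDegree-triangles (suc m) = minDegree-⊕ (complete 3) (triangles m)
  (from-yes (minDegree? 2 (complete 3))) (minDegree-triangles m)

spread-triangles : ∀ m → Spread 4 (triangles m)
spread-triangles zero    = λ ()
spread-triangles (suc m) = spread-⊕ (complete 3) (triangles m)
  (from-yes (spread? 4 (complete 3))) (spread-triangles m)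
  (from-yes (minDegree? 2 (complete 3))) (minDegree-triangles m)

∑degree-triangles : ∀ m → sum (degree (triangles m)) ≡ m * 3 + m * 3
∑degree-triangles zero    = refl
∑degree-triangles (suc m) = begin
  sum (degree (complete 3 ⊕ triangles m))           ≡⟨ ∑degree-⊕ (complete 3) (triangles m) ⟩
  6 + sum (degree (triangles m))                    ≡⟨ cong (6 +_) (∑degree-triangles m) ⟩
  6 + (m * 3 + m * 3)                               ≡⟨ rearrange m ⟩
  suc m * 3 + suc m * 3                             ∎
  where
  open ≡-Reasoning
  rearrange : ∀ m → 6 + (m * 3 + m * 3) ≡ suc m * 3 + suc m * 3
  rearrange = solve-∀

-- The 8-cycle 0 – 1 – ⋯ – 7 – 0 with the two chords 0 – 4 and 1 – 5.
gadgetEdge : ℕ → ℕ → Bool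
gadgetEdge i j = (j ≡ᵇ suc i) ∨ ((i ≡ᵇ 7) ∧ (j ≡ᵇ 0)) ∨ ((i ≡ᵇ 0) ∧ (j ≡ᵇ 4)) ∨ ((i ≡ᵇ 1) ∧ (j ≡ᵇ 5))

gadget : SimpleGraph 8
gadget = record
  { adj    = gadgetAdj
  ; sym    = λ u v → Boolₚ.∨-comm (gadgetEdge (toℕ u) (toℕ v)) _
  ; irrefl = from-yes (Finₚ.all? λ u → gadgetAdj u u Boolₚ.≟ false)
  }
  where
  gadgetAdj : Fin 8 → Fin 8 → Bool
  gadgetAdj u v = gadgetEdge (toℕ u) (toℕ v) ∨ gadgetEdge (toℕ v) (toℕ u)

SpreadWithEdges : ℕ → ℕ → Set
SpreadWithEdges n k = Σ (SimpleGraph n) λ H → Spread 4 H × edgeCount H ≡ k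

paddedGraph : ∀ {a} e (B : SimpleGraph a) → Spread 4 B → MinDegree 2 B →
  sum (degree B) ≡ (a + e) + (a + e) → ∀ m → SpreadWithEdges (a + m * 3) (a + m * 3 + e)
paddedGraph {a} e B spreadB minB ∑degreeB m =
  B ⊕ triangles m ,
  spread-⊕ B (triangles m) spreadB (spread-triangles m) minB (minDegree-triangles m) ,
  m+m≡n+n⇒m≡n (begin
    edgeCount (B ⊕ triangles m) + edgeCount (B ⊕ triangles m)  ≡⟨ handshake (B ⊕ triangles m) ⟩
    sum (degree (B ⊕ triangles m))                              ≡⟨ ∑degree-⊕ B (triangles m) ⟩
    sum (degree B) + sum (degree (triangles m))                 ≡⟨ cong₂ _+_ ∑degreeB (∑degree-triangles m) ⟩
    (a + e) + (a + e) + (m * 3 + m * 3)                         ≡⟨ rearrange a e (m * 3) ⟩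
    (a + m * 3 + e) + (a + m * 3 + e)                           ∎)
  where
  open ≡-Reasoning
  rearrange : ∀ a e t → (a + e) + (a + e) + (t + t) ≡ (a + t + e) + (a + t + e)
  rearrange = solve-∀

extremal-n≡0 : ∀ m → SpreadWithEdges (m * 3) (m * 3 + 0)
extremal-n≡0 = paddedGraph 0 (complete 0) (λ ()) (λ ()) refl

extremal-n≡1 : ∀ m → SpreadWithEdges (4 + m * 3) (4 + m * 3 + 2)
extremal-n≡1 = paddedGraph 2 (complete 4) (from-yes (spread? 4 (complete 4))) (from-yes (minDegree? 2 (complete 4))) refl

extremal-n≡2 : ∀ m → SpreadWithEdges (8 + m * 3) (8 + m * 3 + 2)
extremal-n≡2 = paddedGraph 2 gadget (from-yes (spread? 4 gadget)) (from-yes (minDegree? 2 gadget)) refl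

-- The identity says that a graph on n = p + 5 vertices whose complement has k edges has X / 2 edges.
exBookIs-viaComplement : ∀ p k X → X + (k + k) + (p + 5) ≡ (p + 5) * (p + 5) → SpreadWithEdges (p + 5) k →
  (∀ H → Spread 4 H → k ≤ edgeCount H) →
  ExBookIs (p + 5) p (X / 2)
exBookIs-viaComplement p k X identity (H₀ , spread₀ , E[H₀]≡k) k≤E =
  (G₀ , spread⇒bookFree {G = G₀} {H₀} G₀~H₀ spread₀ , sym (m+m≡n⇒n/2≡m {edgeCount G₀} E[G₀]+E[G₀]≡X)) , upper
  where
  n = p + 5
  G₀ = complement H₀
  G₀~H₀ : Complementary G₀ H₀
  G₀~H₀ = complementary-sym {G = H₀} {G₀} (complement-complementary H₀)
  E[G₀]+E[G₀]≡X : edgeCount G₀ + edgeCount G₀ ≡ X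
  E[G₀]+E[G₀]≡X = +-cancelʳ-≡ (k + k) _ _ (+-cancelʳ-≡ n _ _ (begin
    edgeCount G₀ + edgeCount G₀ + (k + k) + n
      ≡⟨ cong (λ e → edgeCount G₀ + edgeCount G₀ + (e + e) + n) E[H₀]≡k ⟨
    edgeCount G₀ + edgeCount G₀ + (edgeCount H₀ + edgeCount H₀) + n
      ≡⟨ edgeCount-complementary {G = G₀} {H₀} G₀~H₀ ⟩
    n * n
      ≡⟨ identity ⟨
    X + (k + k) + n ∎))
    where open ≡-Reasoning
  upper : ∀ G → ¬ ContainsBook p G → edgeCount G ≤ X / 2
  upper G G-free = m+m≤n⇒m≤n/2 {n = X} (+-cancelʳ-≤ (k + k) _ _ (+-cancelʳ-≤ n _ _ (begin
    edgeCount G + edgeCount G + (k + k) + n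
      ≤⟨ +-monoˡ-≤ n (+-monoʳ-≤ (edgeCount G + edgeCount G) (+-mono-≤ k≤E[Ḡ] k≤E[Ḡ])) ⟩
    edgeCount G + edgeCount G + (edgeCount Ḡ + edgeCount Ḡ) + n
      ≡⟨ edgeCount-complementary {G = G} {Ḡ} (complement-complementary G) ⟩
    n * n
      ≡⟨ identity ⟨
    X + (k + k) + n ∎)))
    where
    open ≤-Reasoning
    Ḡ = complement G
    k≤E[Ḡ] : k ≤ edgeCount Ḡ
    k≤E[Ḡ] = k≤E Ḡ (bookFree⇒spread {G = G} {Ḡ} (complement-complementary G) G-free)

exBook-sparse : ∀ p {n} → p + 5 ≡ n → SpreadWithEdges n (n + 0) → ExBookIs (p + 5) p (((p + 2) * (p + 5)) / 2)
exBook-sparse p n≡p+5 extremal =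
  exBookIs-viaComplement p (p + 5 + 0) ((p + 2) * (p + 5)) (identity p)
    (subst (λ n → SpreadWithEdges n (n + 0)) (sym n≡p+5) extremal)
    λ H spread → ≤-trans (≤-reflexive (+-identityʳ (p + 5)))
                         (spread⇒n≤edgeCount {H = H} spread (≤-trans (n≤1+n 4) (m≤n+m 5 p)))
  where
  identity : ∀ p → (p + 2) * (p + 5) + ((p + 5 + 0) + (p + 5 + 0)) + (p + 5) ≡ (p + 5) * (p + 5)
  identity = solve-∀

exBook-dense : ∀ p {n} → 2 ≤ p → ¬ 3 ∣ p + 5 → p + 5 ≡ n → SpreadWithEdges n (n + 2) →
               ExBookIs (p + 5) p (((p + 1) * (p + 6)) / 2)
exBook-dense p 2≤p 3∤n n≡p+5 extremal =
  exBookIs-viaComplement p (p + 5 + 2) ((p + 1) * (p + 6)) (identity p)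
    (subst (λ n → SpreadWithEdges n (n + 2)) (sym n≡p+5) extremal)
    λ H spread → spread⇒n+2≤edgeCount {H = H} spread (+-monoˡ-≤ 5 2≤p) 3∤n
  where
  identity : ∀ p → (p + 1) * (p + 6) + ((p + 5 + 2) + (p + 5 + 2)) + (p + 5) ≡ (p + 5) * (p + 5)
  identity = solve-∀

data Residue3 : ℕ → Set where
  0+3q : ∀ q → Residue3 (q * 3)
  1+3q : ∀ q → Residue3 (1 + q * 3)
  2+3q : ∀ q → Residue3 (2 + q * 3)

residue3 : ∀ p → Residue3 p
residue3 zero = 0+3q 0
residue3 (suc p) with residue3 p
... | 0+3q q = 1+3q q
... | 1+3q q = 2+3q q
... | 2+3q q = 0+3q (suc q)

3∤q*3+r : ∀ q {r} → ¬ 3 ∣ r → ¬ 3 ∣ q * 3 + r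
3∤q*3+r q 3∤r 3∣q*3+r = 3∤r (∣m+n∣m⇒∣n 3∣q*3+r (divides q refl))

theorem8 : ∀ (p : ℕ) → 1 ≤ p →
    (p % 3 ≡ 1 → ExBookIs (p + 5) p (((p + 2) * (p + 5)) / 2)) ×
    (p % 3 ≢ 1 → ExBookIs (p + 5) p (((p + 1) * (p + 6)) / 2))
theorem8 p 1≤p with residue3 p
... | 0+3q zero    = ⊥-elim (n≮0 1≤p)
... | 0+3q (suc q) =
  (λ p%3≡1 → case trans (sym (m*n%n≡0 (suc q) 3)) p%3≡1 of λ ()) ,
  λ _ → exBook-dense _ (s≤s (s≤s z≤n)) (3∤q*3+r (suc q) (from-no (3 ∣? 5))) (vertices q) (extremal-n≡2 q)
  where
  vertices : ∀ q → suc q * 3 + 5 ≡ 8 + q * 3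
  vertices = solve-∀
... | 1+3q q =
  (λ _ → exBook-sparse _ (vertices q) (extremal-n≡0 (2 + q))) ,
  λ p%3≢1 → ⊥-elim (p%3≢1 ([m+kn]%n≡m%n 1 q 3))
  where
  vertices : ∀ q → 1 + q * 3 + 5 ≡ (2 + q) * 3
  vertices = solve-∀
... | 2+3q q =
  (λ p%3≡1 → case trans (sym ([m+kn]%n≡m%n 2 q 3)) p%3≡1 of λ ()) ,
  λ _ → exBook-dense _ (s≤s (s≤s z≤n)) (subst (¬_ ∘ (3 ∣_)) (n≡ q) (3∤q*3+r q (from-no (3 ∣? 7))))
                     (vertices q) (extremal-n≡1 (suc q))
  where
  n≡ : ∀ q → q * 3 + 7 ≡ 2 + q * 3 + 5
  n≡ = solve-∀
  vertices : ∀ q → 2 + q * 3 + 5 ≡ 4 + (1 + q) * 3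
  vertices = solve-∀
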